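{- Let $r \geq 2$ and let $v = v_1 v_2 \cdots v_{|v|}$ be an element of the Young–Fibonacci lattice $\mathbb{YF}$ of rank $r$. Then $v$ is an Eeta win if and only if one of the following holds: (i) the prefix $v_{1:|v|-1} = v_1 v_2 \cdots v_{|v|-1}$ consists only of $1$s (it may be empty) and the total number of $1$s in $v$ is even; or (ii) the prefix $v_{1:|v|-1}$ does not consist only of $1$s, and the number of $1$s to the left of the leftmost $2$ in $v$ is odd.
   Context: Ungar game. Let $L$ be a finite meet-semilattice with minimum $\hat 0$. An Ungar move from $v \in L$ sends $v$ to the meet $\bigwedge(\{v\}\cup T)$, where $T$ is a subset of the set of elements covered by $v$; the move is nontrivial if $T \neq \emptyset$. The Ungar game starting at $v$ is played on the interval $[\hat 0, v]$: two players, Atniss (who moves first) and Eeta, alternately make nontrivial Ungar moves from the current element; the player who cannot make a nontrivial Ungar move loses. The element $v$ is an Atniss win if Atniss has a winning strategy in this game, and an Eeta win otherwise. (Equivalently: $v$ is an Eeta win iff every element reachable from $v$ by a nontrivial Ungar move is an Atniss win.) Young–Fibonacci lattice. The elements of $\mathbb{YF}$ are all finite words (including the empty word) over the alphabet $\{1,2\}$. The rank of $v = v_1\cdots v_{|v|}$ is $\rho(v)=\sum_{i=1}^{|v|} v_i$. For words $u,v$, $v$ covers $u$ if and only if either $v = u_{1:i}\,1\,u_{i+1:|u|}$ for some $i$ such that $u_{1:i}$ contains no $1$s, or $v = u_{1:i-1}\,2\,u_{i+1:|u|}$ where $u_i$ is the leftmost $1$ in $u$. Here $u_{i:j}=u_iu_{i+1}\cdots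 u_j$, and $u_{i:j}$ is the empty word if $i>j$. The partial order is the transitive-reflexive closure of this covering relation; $\mathbb{YF}$ is a lattice. -}

module Defs where

open import Data.Nat using (ℕ; zero; suc; _+_)
open import Data.Nat.Divisibility using (_∣_)
open import Data.List using (List; []; _∷_; _++_)
open import Data.List.Relation.Unary.All using (All)
open import Data.List.Membership.Propositional using (_∈_)
open import Data.Product using (Σ; _×_; ∃; ∃-syntax)
open import Relation.Binary.PropositionalEquality using (_≡_)
open import Relation.Binary.Construct.Closure.ReflexiveTransitive using (Star)
open import Relation.Nullary using (¬_)

data Letter : Set where
  one two : Letter

-- Elements of the Young–Fibonacci lattice: finite words over {1,2}
Word : Set
Word = List Letter

val : Letter → ℕ
val one = 1
val two = 2

rank : Word → ℕ
rank [] = 0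
rank (a ∷ w) = val a + rank w

countOnes : Word → ℕ
countOnes [] = 0
countOnes (one ∷ w) = suc (countOnes w)
countOnes (two ∷ w) = countOnes w

beforeFirstTwo : Word → Word
beforeFirstTwo [] = []
beforeFirstTwo (one ∷ w) = one ∷ beforeFirstTwo w
beforeFirstTwo (two ∷ w) = []

dropLast : Word → Word
dropLast [] = []
dropLast (a ∷ []) = []
dropLast (a ∷ b ∷ w) = a ∷ dropLast (b ∷ w)

-- Covering relation: u ⋖ v  means  v covers u.
-- (a) v = u_{1:i} 1 u_{i+1:|u|} with u_{1:i} containing no 1s;
-- (b) v = u_{1:i-1} 2 u_{i+1:|u|} where u_i is the leftmost 1 of u.
data _⋖_ : Word → Word → Set where
  insert1 : (p s : Word) → All (_≡ two) p → (p ++ s) ⋖ (p ++ one ∷ s)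
  leftmost1to2 : (p s : Word) → All (_≡ two) p → (p ++ one ∷ s) ⋖ (p ++ two ∷ s)

_≤YF_ : Word → Word → Set
_≤YF_ = Star _⋖_

IsMeet : List Word → Word → Set
IsMeet S w = (∀ {t} → t ∈ S → w ≤YF t)
           × (∀ z → (∀ {t} → t ∈ S → z ≤YF t) → z ≤YF w)

UngarMove : Word → Word → Set
UngarMove v w = Σ (List Word) λ T → ¬ (T ≡ []) × All (_⋖ v) T × IsMeet (v ∷ T) w

-- Game outcomes (finite game: ranks strictly decrease, so the inductive
-- definitions capture winning strategies exactly).
data EetaWin : Word → Set
data AtnissWin : Word → Set

data EetaWin where
  eetaWin : ∀ {v} → (∀ w → UngarMove v w → AtnissWin w) → EetaWin v

data AtnissWin where
  atnissWin : ∀ {v} w → UngarMove v w → EetaWin w → AtnissWin v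

Even Odd : ℕ → Set
Even n = 2 ∣ n
Odd n = ¬ (2 ∣ n)

-- The only lower cover of 1s is s and that of 2 is 1, so every move from 1s goes to s and from
-- 2 to 1: 1s wins exactly when s loses, and 2 is an Eeta win like []. From 2t with t nonempty one
-- may move to 1t, or to t, the meet of 1t and 2u for u ⋖ t ⋖ 2u; since 1t and t have opposite
-- outcomes, 2t is an Atniss win. So the outcome of v is that of v with its leading 1s deleted,
-- flipped once per deleted 1, which is the parity condition of the theorem.
module Submission where

open import Defs
open import Data.Nat using (ℕ; zero; suc; _+_; _≤_; _<_)
open import Data.Nat.Properties using (+-suc; ≤-refl; ≤-trans; ≤-reflexive; ≤-antisym; <⇒≤; <-≤-trans; <-irrefl)
open import Data.Nat.Divisibility using (_∣0; ∣-refl; ∣1⇒≡1; ∣m∣n⇒∣m+n; ∣m+n∣m⇒∣n; _∣?_)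
open import Data.Product using (_×_; _,_; ∃-syntax)
open import Data.Sum using (_⊎_; inj₁; inj₂)
open import Data.Empty using (⊥-elim)
open import Data.List using ([]; _∷_; _++_)
open import Data.List.Relation.Unary.All as All using (All; []; _∷_; all?)
open import Data.List.Relation.Unary.Any using (here; there)
open import Data.List.Membership.Propositional using (_∈_)
open import Relation.Binary.Core using (Rel)
open import Relation.Binary.PropositionalEquality using (_≡_; refl; sym; trans; cong; subst)
open import Relation.Binary.Construct.Closure.ReflexiveTransitive using (Star; ε; _◅_)
open import Relation.Nullary using (¬_; Dec; yes; no)
open import Relation.Nullary.Decidable using (decidable-stable)
open import Function using (_∘_; case_of_)
open import Function.Bundles using (_⇔_; mk⇔)

module _ {a ℓ} {A : Set a} {_<·_ : Rel A ℓ} where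

  star-below-uniqueCover : ∀ {c v z} → (∀ {u} → u <· v → u ≡ c) →
                           Star _<·_ z v → z ≡ v ⊎ Star _<·_ z c
  star-below-uniqueCover uniq ε = inj₁ refl
  star-below-uniqueCover uniq (z<·y ◅ y≤v) with star-below-uniqueCover uniq y≤v
  ... | inj₁ refl = inj₂ (subst (Star _<·_ _) (uniq z<·y) ε)
  ... | inj₂ y≤c = inj₂ (z<·y ◅ y≤c)

  module StrictlyMonotone (ρ : A → ℕ) (ρ-mono : ∀ {x y} → x <· y → ρ x < ρ y) where

    star-ρ-mono : ∀ {x y} → Star _<·_ x y → ρ x ≤ ρ y
    star-ρ-mono ε = ≤-refl
    star-ρ-mono (x<·z ◅ z≤y) = ≤-trans (<⇒≤ (ρ-mono x<·z)) (star-ρ-mono z≤y)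

    star-ρ-injective : ∀ {x y} → Star _<·_ x y → ρ x ≡ ρ y → x ≡ y
    star-ρ-injective ε _ = refl
    star-ρ-injective (x<·z ◅ z≤y) eq = ⊥-elim (<-irrefl eq (<-≤-trans (ρ-mono x<·z) (star-ρ-mono z≤y)))

    star-antisym : ∀ {x y} → Star _<·_ x y → Star _<·_ y x → x ≡ y
    star-antisym x≤y y≤x = star-ρ-injective x≤y (≤-antisym (star-ρ-mono x≤y) (star-ρ-mono y≤x))

even-2+ : ∀ {n} → Even n → Even (2 + n)
even-2+ = ∣m∣n⇒∣m+n ∣-refl

even-2+⁻ : ∀ {n} → Even (2 + n) → Even n
even-2+⁻ e = ∣m+n∣m⇒∣n e ∣-refl

odd-1 : Odd 1
odd-1 e = case ∣1⇒≡1 e of λ ()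

even⇒odd-suc : ∀ n → Even n → Odd (suc n)
even⇒odd-suc zero _ = odd-1
even⇒odd-suc (suc zero) e = ⊥-elim (odd-1 e)
even⇒odd-suc (suc (suc n)) e = even⇒odd-suc n (even-2+⁻ e) ∘ even-2+⁻

odd⇒even-suc : ∀ n → Odd n → Even (suc n)
odd⇒even-suc zero o = ⊥-elim (o (2 ∣0))
odd⇒even-suc (suc zero) _ = ∣-refl
odd⇒even-suc (suc (suc n)) o = even-2+ (odd⇒even-suc n (o ∘ even-2+))

rank-++-suc : ∀ p {s t} → rank t ≡ suc (rank s) → rank (p ++ t) ≡ suc (rank (p ++ s))
rank-++-suc [] eq = eq
rank-++-suc (a ∷ p) eq = trans (cong (val a +_) (rank-++-suc p eq)) (+-suc (val a) _)

rank-cover : ∀ {u v} → u ⋖ v → rank v ≡ suc (rank u)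
rank-cover (insert1 p s _) = rank-++-suc p refl
rank-cover (leftmost1to2 p s _) = rank-++-suc p refl

open StrictlyMonotone {_<·_ = _⋖_} rank (≤-reflexive ∘ sym ∘ rank-cover)

⋖-two∷ : ∀ {u t} → u ⋖ t → (two ∷ u) ⋖ (two ∷ t)
⋖-two∷ (insert1 p s twos) = insert1 (two ∷ p) s (refl ∷ twos)
⋖-two∷ (leftmost1to2 p s twos) = leftmost1to2 (two ∷ p) s (refl ∷ twos)

lowerCover-one∷ : ∀ {u s} → u ⋖ (one ∷ s) → u ≡ s
lowerCover-one∷ c = go c refl
  where
  go : ∀ {u v s} → u ⋖ v → v ≡ one ∷ s → u ≡ s
  go (insert1 [] _ _) refl = refl
  go (insert1 (.two ∷ _) _ (refl ∷ _)) ()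
  go (leftmost1to2 [] _ _) ()
  go (leftmost1to2 (.two ∷ _) _ (refl ∷ _)) ()

lowerCover-two : ∀ {u} → u ⋖ (two ∷ []) → u ≡ one ∷ []
lowerCover-two c = go c refl
  where
  go : ∀ {u v} → u ⋖ v → v ≡ two ∷ [] → u ≡ one ∷ []
  go (insert1 [] _ _) ()
  go (insert1 (.two ∷ []) _ (refl ∷ _)) ()
  go (insert1 (.two ∷ _ ∷ _) _ (refl ∷ _)) ()
  go (leftmost1to2 [] _ _) refl = refl
  go (leftmost1to2 (.two ∷ []) _ (refl ∷ _)) ()
  go (leftmost1to2 (.two ∷ _ ∷ _) _ (refl ∷ _)) ()

lowerCover-[] : ∀ {u} → ¬ (u ⋖ [])
lowerCover-[] c = go c refl
  where
  go : ∀ {u v} → u ⋖ v → ¬ (v ≡ [])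
  go (insert1 [] _ _) ()
  go (insert1 (_ ∷ _) _ _) ()
  go (leftmost1to2 [] _ _) ()
  go (leftmost1to2 (_ ∷ _) _ _) ()

isMeet-unique : ∀ {S w w′} → IsMeet S w → IsMeet S w′ → w ≡ w′
isMeet-unique (w≤S , w-greatest) (w′≤S , w′-greatest) =
  star-antisym (w′-greatest _ w≤S) (w-greatest _ w′≤S)

isMeet-constant : ∀ {v c T} → c ≤YF v → ¬ (T ≡ []) → All (_≡ c) T → IsMeet (v ∷ T) c
isMeet-constant {T = []} _ T≢[] _ = ⊥-elim (T≢[] refl)
isMeet-constant {v} {c} {T = t ∷ T} c≤v _ (refl ∷ T≡c) = c≤vT , greatest
  where
  c≤vT : ∀ {x} → x ∈ v ∷ t ∷ T → c ≤YF x
  c≤vT (here refl) = c≤v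
  c≤vT (there (here refl)) = ε
  c≤vT (there (there x∈T)) = subst (c ≤YF_) (sym (All.lookup T≡c x∈T)) ε
  greatest : ∀ z → (∀ {x} → x ∈ v ∷ t ∷ T → z ≤YF x) → z ≤YF c
  greatest z z≤vT = z≤vT (there (here refl))

move-cover : ∀ {u v} → u ⋖ v → UngarMove v u
move-cover u⋖v = (_ ∷ []) , (λ ()) , (u⋖v ∷ []) , isMeet-constant (u⋖v ◅ ε) (λ ()) (refl ∷ [])

move-uniqueCover : ∀ {v c w} → (∀ {u} → u ⋖ v → u ≡ c) → c ⋖ v → UngarMove v w → w ≡ c
move-uniqueCover uniq c⋖v (T , T≢[] , T⋖v , w-meet) =
  isMeet-unique w-meet (isMeet-constant (c⋖v ◅ ε) T≢[] (All.map uniq T⋖v))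

-- The only lower cover of 1t is t, and 1t is not below 2u, which has the same rank.
move-two-drop : ∀ {u t} → u ⋖ t → t ⋖ (two ∷ u) → UngarMove (two ∷ t) t
move-two-drop {u} {t} u⋖t t⋖2u =
  ((one ∷ t) ∷ (two ∷ u) ∷ []) , (λ ()) , (leftmost1to2 [] t [] ∷ ⋖-two∷ u⋖t ∷ []) , t≤S , greatest
  where
  t≤S : ∀ {x} → x ∈ (two ∷ t) ∷ (one ∷ t) ∷ (two ∷ u) ∷ [] → t ≤YF x
  t≤S (here refl) = insert1 [] t [] ◅ leftmost1to2 [] t [] ◅ ε
  t≤S (there (here refl)) = insert1 [] t [] ◅ ε
  t≤S (there (there (here refl))) = t⋖2u ◅ ε
  greatest : ∀ z → (∀ {x} → x ∈ (two ∷ t) ∷ (one ∷ t) ∷ (two ∷ u) ∷ [] → z ≤YF x) → z ≤YF t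
  greatest z z≤S with star-below-uniqueCover lowerCover-one∷ (z≤S (there (here refl)))
  ... | inj₂ z≤t = z≤t
  ... | inj₁ refl = case star-ρ-injective (z≤S (there (there (here refl)))) (cong suc (rank-cover u⋖t)) of λ ()

cover-two-drop : ∀ b s → ∃[ u ] u ⋖ (b ∷ s) × (b ∷ s) ⋖ (two ∷ u)
cover-two-drop one s = s , insert1 [] s [] , leftmost1to2 [] s []
cover-two-drop two s = one ∷ s , leftmost1to2 [] s [] , insert1 (two ∷ []) s (refl ∷ [])

eetaWin⇒¬atnissWin : ∀ {v} → EetaWin v → ¬ AtnissWin v
eetaWin⇒¬atnissWin (eetaWin all-atniss) (atnissWin w v→w eeta-w) = eetaWin⇒¬atnissWin eeta-w (all-atniss w v→w)

eetaWin-[] : EetaWin []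
eetaWin-[] = eetaWin λ { _ (_ ∷ _ , _ , c ∷ _ , _) → ⊥-elim (lowerCover-[] c)
                       ; _ ([] , []≢[] , _) → ⊥-elim ([]≢[] refl) }

eetaWin-uniqueCover : ∀ {v c} → (∀ {u} → u ⋖ v → u ≡ c) → c ⋖ v → AtnissWin c → EetaWin v
eetaWin-uniqueCover uniq c⋖v atniss-c =
  eetaWin λ w v→w → subst AtnissWin (sym (move-uniqueCover uniq c⋖v v→w)) atniss-c

atnissWin-cover : ∀ {u v} → u ⋖ v → EetaWin u → AtnissWin v
atnissWin-cover u⋖v = atnissWin _ (move-cover u⋖v)

ParityCondition : Word → ℕ → ℕ → Set
ParityCondition d n m = (All (_≡ one) d × Even n) ⊎ (¬ All (_≡ one) d × Odd m)

EetaCondition : Word → Set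
EetaCondition v = ParityCondition (dropLast v) (countOnes v) (countOnes (beforeFirstTwo v))

one? : (a : Letter) → Dec (a ≡ one)
one? one = yes refl
one? two = no λ ()

parityCondition-suc : ∀ {d n m} → ParityCondition d n m → ¬ ParityCondition (one ∷ d) (suc n) (suc m)
parityCondition-suc (inj₁ (_ , even-n)) (inj₁ (_ , even-1+n)) = even⇒odd-suc _ even-n even-1+n
parityCondition-suc (inj₁ (ones , _)) (inj₂ (¬ones , _)) = ¬ones (refl ∷ ones)
parityCondition-suc (inj₂ (¬ones , _)) (inj₁ (ones , _)) = ¬ones (All.tail ones)
parityCondition-suc (inj₂ (_ , odd-m)) (inj₂ (_ , odd-1+m)) = odd-1+m (odd⇒even-suc _ odd-m)

¬parityCondition-suc : ∀ {d n m} → ¬ ParityCondition d n m → ParityCondition (one ∷ d) (suc n) (suc m)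
¬parityCondition-suc {d} {n} {m} ¬cond with all? one? d
... | yes ones = inj₁ (refl ∷ ones , odd⇒even-suc n λ even-n → ¬cond (inj₁ (ones , even-n)))
... | no ¬ones = inj₂ (¬ones ∘ All.tail , even⇒odd-suc m (decidable-stable (2 ∣? m) λ odd-m → ¬cond (inj₂ (¬ones , odd-m))))

eetaCondition-[] : EetaCondition []
eetaCondition-[] = inj₁ ([] , 2 ∣0)

¬eetaCondition-one : ¬ EetaCondition (one ∷ [])
¬eetaCondition-one (inj₁ (_ , even-1)) = odd-1 even-1
¬eetaCondition-one (inj₂ (¬ones , _)) = ¬ones []

¬eetaCondition-two∷ : ∀ b s → ¬ EetaCondition (two ∷ b ∷ s)
¬eetaCondition-two∷ b s (inj₁ (() ∷ _ , _))
¬eetaCondition-two∷ b s (inj₂ (_ , odd-0)) = odd-0 (2 ∣0)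

outcome : ∀ v → (EetaCondition v × EetaWin v) ⊎ (¬ EetaCondition v × AtnissWin v)
outcome [] = inj₁ (eetaCondition-[] , eetaWin-[])
outcome (one ∷ []) = inj₂ (¬eetaCondition-one , atnissWin-cover (insert1 [] [] []) eetaWin-[])
outcome (one ∷ w@(_ ∷ _)) with outcome w
... | inj₁ (cond , eeta) = inj₂ (parityCondition-suc cond , atnissWin-cover (insert1 [] w []) eeta)
... | inj₂ (¬cond , atniss) = inj₁ (¬parityCondition-suc ¬cond , eetaWin-uniqueCover lowerCover-one∷ (insert1 [] w []) atniss)
outcome (two ∷ []) = inj₁ (eetaCondition-[] ,
  eetaWin-uniqueCover lowerCover-two (leftmost1to2 [] [] []) (atnissWin-cover (insert1 [] [] []) eetaWin-[]))
outcome (two ∷ w@(b ∷ s)) = inj₂ (¬eetaCondition-two∷ b s , atniss-2w (outcome w))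
  where
  atniss-2w : (EetaCondition w × EetaWin w) ⊎ (¬ EetaCondition w × AtnissWin w) → AtnissWin (two ∷ w)
  atniss-2w (inj₁ (_ , eeta)) with cover-two-drop b s
  ... | _ , u⋖w , w⋖2u = atnissWin w (move-two-drop u⋖w w⋖2u) eeta
  atniss-2w (inj₂ (_ , atniss)) =
    atnissWin-cover (leftmost1to2 [] w []) (eetaWin-uniqueCover lowerCover-one∷ (insert1 [] w []) atniss)

theorem1p1 : (v : Word) → 2 ≤ rank v →
    EetaWin v ⇔
      ((All (_≡ one) (dropLast v) × Even (countOnes v))
       ⊎ (¬ All (_≡ one) (dropLast v) × Odd (countOnes (beforeFirstTwo v))))
theorem1p1 v _ = mk⇔ eeta⇒cond cond⇒eeta
  where
  eeta⇒cond : EetaWin v → EetaCondition v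
  eeta⇒cond eeta with outcome v
  ... | inj₁ (cond , _) = cond
  ... | inj₂ (_ , atniss) = ⊥-elim (eetaWin⇒¬atnissWin eeta atniss)
  cond⇒eeta : EetaCondition v → EetaWin v
  cond⇒eeta cond with outcome v
  ... | inj₁ (_ , eeta) = eeta
  ... | inj₂ (¬cond , _) = ⊥-elim (¬cond cond)
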